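{- For every $n\geq 2$, \[c_n=\frac{n^2-n}{2}-\lfloor \log_2(n-1)\rfloor-\sum_{j=2}^{\lfloor \frac{n-2}{2}\rfloor}j\left\lfloor 1+\log_2\frac{n-1}{2j+1}\right\rfloor.\]
   Context: The sequence $(c_n)_{n\geq 2}$ is defined by $c_2=1$, $c_3=2$, and $c_n=\lfloor \frac{n}{2}\rfloor\lceil \frac{n}{2}\rceil+c_{\lceil n/2\rceil}$ for $n>3$. An empty sum is $0$. -}

module Defs where

open import Data.Nat using (ℕ; zero; suc; _+_; _*_; _∸_; _^_; _≤_; _<_; _≤ᵇ_; ⌊_/2⌋; ⌈_/2⌉)
open import Data.Bool using (if_then_else_)
open import Data.List using (map; upTo; drop)
open import Data.Nat.ListAction using (sum)

-- c' fuel n : the recursion of the paper, with fuel (fuel ≥ n suffices,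
-- since ⌈n/2⌉ < n for n > 3).
-- c_2 = 1, c_3 = 2, c_n = ⌊n/2⌋⌈n/2⌉ + c_{⌈n/2⌉} for n > 3.
-- (values at n = 0, 1 are irrelevant junk: 0)
c' : ℕ → ℕ → ℕ
c' zero    n = 0
c' (suc f) 0 = 0
c' (suc f) 1 = 0
c' (suc f) 2 = 1
c' (suc f) 3 = 2
c' (suc f) n@(suc (suc (suc (suc _)))) = ⌊ n /2⌋ * ⌈ n /2⌉ + c' f ⌈ n /2⌉

c : ℕ → ℕ
c n = c' n n

-- ⌊log₂ (a / b)⌋ for the rational a/b with a ≥ b ≥ 1:
-- the largest k such that b * 2^k ≤ a.  Computed by searching k = 0, 1, …
-- with fuel a (since 2^k ≥ k+1, k ≤ a always).
-- go fuel k : assumes b * 2^k ≤ a; returns the largest such k.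
floorLog2Ratio : ℕ → ℕ → ℕ
floorLog2Ratio a b = go a 0
  where
  go : ℕ → ℕ → ℕ
  go zero    k = k
  go (suc f) k = if (b * 2 ^ suc k) ≤ᵇ a then go f (suc k) else k

sumFromTo : ℕ → ℕ → (ℕ → ℕ) → ℕ
sumFromTo lo hi f = sum (map f (drop lo (upTo (suc hi))))

{-# OPTIONS --safe #-}
module Submission where

-- Put m = n − 1. For 1 ≤ d ≤ m, 1 + ⌊log₂ (m / d)⌋ counts the k ≥ 0 with d·2^k ≤ m, and
-- d·2^(k+1) ≤ m iff d·2^k ≤ ⌊m/2⌋. So replacing m by ⌊m/2⌋ lowers by one every factor
-- 1 + ⌊log₂ (m / (2j+1))⌋ of the sum, and the terms it drops are exactly those whose factor
-- was 1. Writing S m for the sum over 2 ≤ j < ⌈m/2⌉ (i.e. 2j + 1 ≤ m), this gives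
-- S m = Σ_{2 ≤ j < ⌈m/2⌉} j + S ⌊m/2⌋. Together with ⌊log₂ m⌋ = 1 + ⌊log₂ ⌊m/2⌋⌋ and
-- c_{m+1} = ⌈m/2⌉ (⌊m/2⌋ + 1) + c_{⌊m/2⌋+1}, the quantity c_{m+1} + ⌊log₂ m⌋ + S m follows the
-- splitting rule T (a + b) = T a + a b + T b of the triangular numbers T k = Σ_{i<k} i at
-- a = ⌈m/2⌉, b = ⌊m/2⌋ + 1; as it equals T (m + 1) = (n² − n)/2 for m = 1, 2, strong
-- induction on m concludes.

open import Data.Bool using (true; false; if_then_else_)
import Data.Integer as ℤ
open import Data.Integer.Properties using (pos-+)
import Data.Integer.Tactic.RingSolver as ℤ-Solver
open import Data.List using (applyUpTo; drop; map; _++_; [_])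
open import Data.List.Properties using (applyUpTo-∷ʳ; map-applyUpTo)
open import Data.Nat
open import Data.Nat.Induction using (<-rec)
open import Data.Nat.ListAction using (sum)
open import Data.Nat.ListAction.Properties using (sum-++)
open import Data.Nat.Logarithm using (⌊log₂_⌋; ⌊log₂⌋-mono-≤; ⌊log₂⌊n/2⌋⌋≡⌊log₂n⌋∸1)
open import Data.Nat.Properties
open import Algebra.Properties.CommutativeSemigroup +-commutativeSemigroup using (interchange)
open import Data.Nat.Tactic.RingSolver using (solve-∀)
open import Function using (id)
open import Relation.Binary.PropositionalEquality
  using (_≡_; refl; sym; trans; cong; cong₂; subst; module ≡-Reasoning)
open import Relation.Nullary.Reflects using (ofʸ; ofⁿ)

open import Defs

sumBelow : ℕ → (ℕ → ℕ) → ℕ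
sumBelow k f = sum (applyUpTo f k)

sumBelow-suc : ∀ k f → sumBelow (suc k) f ≡ sumBelow k f + f k
sumBelow-suc k f = begin
  sum (applyUpTo f (suc k))      ≡⟨ cong sum (applyUpTo-∷ʳ f k) ⟨
  sum (applyUpTo f k ++ [ f k ]) ≡⟨ sum-++ (applyUpTo f k) [ f k ] ⟩
  sumBelow k f + (f k + 0)       ≡⟨ cong (sumBelow k f +_) (+-identityʳ (f k)) ⟩
  sumBelow k f + f k             ∎
  where open ≡-Reasoning

sumBelow-cong : ∀ k {f g} → (∀ i → i < k → f i ≡ g i) → sumBelow k f ≡ sumBelow k g
sumBelow-cong zero    f≗g = refl
sumBelow-cong (suc k) f≗g =
  cong₂ _+_ (f≗g 0 z<s) (sumBelow-cong k (λ i i<k → f≗g (suc i) (s<s i<k)))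

sumBelow-+ : ∀ k f g → sumBelow k (λ i → f i + g i) ≡ sumBelow k f + sumBelow k g
sumBelow-+ zero    f g = refl
sumBelow-+ (suc k) f g = trans
  (cong (f 0 + g 0 +_) (sumBelow-+ k (λ i → f (suc i)) (λ i → g (suc i))))
  (interchange (f 0) (g 0) (sumBelow k (λ i → f (suc i))) (sumBelow k (λ i → g (suc i))))

sumBelow-truncate : ∀ {K N} f → K ≤ N → (∀ i → K ≤ i → i < N → f i ≡ 0) →
                    sumBelow N f ≡ sumBelow K f
sumBelow-truncate f K≤N = go (≤⇒≤′ K≤N)
  where
  go : ∀ {K N} → K ≤′ N → (∀ i → K ≤ i → i < N → f i ≡ 0) → sumBelow N f ≡ sumBelow K f
  go (≤′-reflexive refl) _ = refl
  go {K} {suc N} (≤′-step K≤′N) vanish = begin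
    sumBelow (suc N) f ≡⟨ sumBelow-suc N f ⟩
    sumBelow N f + f N ≡⟨ cong (sumBelow N f +_) (vanish N (≤′⇒≤ K≤′N) ≤-refl) ⟩
    sumBelow N f + 0   ≡⟨ +-identityʳ (sumBelow N f) ⟩
    sumBelow N f       ≡⟨ go K≤′N (λ i K≤i i<N → vanish i K≤i (m<n⇒m<1+n i<N)) ⟩
    sumBelow K f       ∎
    where open ≡-Reasoning

drop-applyUpTo : ∀ {a} {A : Set a} lo (f : ℕ → A) n →
                 drop lo (applyUpTo f n) ≡ applyUpTo (λ i → f (lo + i)) (n ∸ lo)
drop-applyUpTo zero     f n       = refl
drop-applyUpTo (suc lo) f zero    = refl
drop-applyUpTo (suc lo) f (suc n) = drop-applyUpTo lo (λ i → f (suc i)) n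

sumFromTo≡sumBelow : ∀ lo hi f → sumFromTo lo hi f ≡ sumBelow (suc hi ∸ lo) (λ i → f (lo + i))
sumFromTo≡sumBelow lo hi f = trans
  (cong (λ xs → sum (map f xs)) (drop-applyUpTo lo id (suc hi)))
  (cong sum (map-applyUpTo (lo +_) f (suc hi ∸ lo)))

triangular : ℕ → ℕ
triangular k = sumBelow k id

triangular-suc : ∀ k → triangular (suc k) ≡ triangular k + k
triangular-suc k = sumBelow-suc k id

triangular-+ : ∀ a b → triangular (a + b) ≡ triangular a + a * b + triangular b
triangular-+ a zero    = trans (cong triangular (+-identityʳ a)) (pad (triangular a) a)
  where
  pad : ∀ t a → t ≡ t + a * 0 + 0
  pad = solve-∀
triangular-+ a (suc b) = begin
  triangular (a + suc b)                        ≡⟨ cong triangular (+-suc a b) ⟩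
  triangular (suc (a + b))                      ≡⟨ triangular-suc (a + b) ⟩
  triangular (a + b) + (a + b)                  ≡⟨ cong (_+ (a + b)) (triangular-+ a b) ⟩
  triangular a + a * b + triangular b + (a + b) ≡⟨ regroup (triangular a) (triangular b) a b ⟩
  triangular a + a * suc b + (triangular b + b) ≡⟨ cong (triangular a + a * suc b +_) (triangular-suc b) ⟨
  triangular a + a * suc b + triangular (suc b) ∎
  where
  open ≡-Reasoning
  regroup : ∀ s t a b → s + a * b + t + (a + b) ≡ s + a * suc b + (t + b)
  regroup = solve-∀

triangular-double : ∀ n → triangular n + triangular n + n ≡ n * n
triangular-double zero    = refl
triangular-double (suc n) = begin
  triangular (suc n) + triangular (suc n) + suc n ≡⟨ cong (λ t → t + t + suc n) (triangular-suc n) ⟩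
  triangular n + n + (triangular n + n) + suc n   ≡⟨ regroup (triangular n) n ⟩
  triangular n + triangular n + n + (n + suc n)   ≡⟨ cong (_+ (n + suc n)) (triangular-double n) ⟩
  n * n + (n + suc n)                             ≡⟨ square-suc n ⟩
  suc n * suc n                                   ∎
  where
  open ≡-Reasoning
  regroup : ∀ t n → t + n + (t + n) + suc n ≡ t + t + n + (n + suc n)
  regroup = solve-∀
  square-suc : ∀ n → n * n + (n + suc n) ≡ suc n * suc n
  square-suc = solve-∀

triangular≡⌊n²∸n/2⌋ : ∀ n → triangular n ≡ ⌊ (n * n ∸ n) /2⌋
triangular≡⌊n²∸n/2⌋ n = begin
  triangular n          ≡⟨ n≡⌊n+n/2⌋ t ⟩
  ⌊ (t + t) /2⌋         ≡⟨ cong ⌊_/2⌋ (m+n∸n≡m (t + t) n) ⟨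
  ⌊ (t + t + n ∸ n) /2⌋ ≡⟨ cong (λ x → ⌊ (x ∸ n) /2⌋) (triangular-double n) ⟩
  ⌊ (n * n ∸ n) /2⌋     ∎
  where
  open ≡-Reasoning
  t = triangular n

m+m≤n⇒m≤⌊n/2⌋ : ∀ {m n} → m + m ≤ n → m ≤ ⌊ n /2⌋
m+m≤n⇒m≤⌊n/2⌋ {m} m+m≤n = ≤-trans (≤-reflexive (n≡⌊n+n/2⌋ m)) (⌊n/2⌋-mono m+m≤n)

m≤⌊n/2⌋⇒m+m≤n : ∀ {m n} → m ≤ ⌊ n /2⌋ → m + m ≤ n
m≤⌊n/2⌋⇒m+m≤n {m} {n} m≤⌊n/2⌋ = begin
  m + m             ≤⟨ +-mono-≤ m≤⌊n/2⌋ (≤-trans m≤⌊n/2⌋ (⌊n/2⌋≤⌈n/2⌉ n)) ⟩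
  ⌊ n /2⌋ + ⌈ n /2⌉ ≡⟨ ⌊n/2⌋+⌈n/2⌉≡n n ⟩
  n                 ∎
  where open ≤-Reasoning

⌊n/2⌋<m⇒n<m+m : ∀ {m n} → ⌊ n /2⌋ < m → n < m + m
⌊n/2⌋<m⇒n<m+m ⌊n/2⌋<m = ≰⇒> (λ m+m≤n → <⇒≱ ⌊n/2⌋<m (m+m≤n⇒m≤⌊n/2⌋ m+m≤n))

[1+m]+[1+m]≡1+[2m+1] : ∀ m → suc m + suc m ≡ suc (2 * m + 1)
[1+m]+[1+m]≡1+[2m+1] = solve-∀

m<⌈n/2⌉⇒2m+1≤n : ∀ m {n} → m < ⌈ n /2⌉ → 2 * m + 1 ≤ n
m<⌈n/2⌉⇒2m+1≤n m {n} m<⌈n/2⌉ =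
  ≤-pred (subst (_≤ suc n) ([1+m]+[1+m]≡1+[2m+1] m) (m≤⌊n/2⌋⇒m+m≤n m<⌈n/2⌉))

⌈n/2⌉≤m⇒n<2m+1 : ∀ m {n} → ⌈ n /2⌉ ≤ m → n < 2 * m + 1
⌈n/2⌉≤m⇒n<2m+1 m {n} ⌈n/2⌉≤m =
  ≤-pred (subst (suc n <_) ([1+m]+[1+m]≡1+[2m+1] m) (⌊n/2⌋<m⇒n<m+m (s≤s ⌈n/2⌉≤m)))

2m+1-nonZero : ∀ m → NonZero (2 * m + 1)
2m+1-nonZero m = subst NonZero (+-comm 1 (2 * m)) _

m<n∸o⇒o+m<n : ∀ {m n o} → m < n ∸ o → o + m < n
m<n∸o⇒o+m<n {o = zero}              m<n   = m<n
m<n∸o⇒o+m<n {n = suc n} {o = suc o} m<n∸o = s≤s (m<n∸o⇒o+m<n {n = n} {o} m<n∸o)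

⌊log₂⌋-half : ∀ m → 2 ≤ m → ⌊log₂ m ⌋ ≡ suc ⌊log₂ ⌊ m /2⌋ ⌋
⌊log₂⌋-half m 2≤m =
  trans (sym (m+[n∸m]≡n (⌊log₂⌋-mono-≤ 2≤m))) (cong suc (sym (⌊log₂⌊n/2⌋⌋≡⌊log₂n⌋∸1 m)))

n<2^n : ∀ n → n < 2 ^ n
n<2^n zero    = z<s
n<2^n (suc n) = +-mono-≤-< (m^n>0 2 n) (≤-trans (n<2^n n) (m≤m+n (2 ^ n) 0))

*-2^-suc : ∀ b k → b * 2 ^ suc k ≡ b * 2 ^ k + b * 2 ^ k
*-2^-suc b k = double b (2 ^ k)
  where
  double : ∀ b p → b * (2 * p) ≡ b * p + b * p
  double = solve-∀

*-2^-reflect-< : ∀ b {a x y} → b * 2 ^ x ≤ a → a < b * 2 ^ y → x < y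
*-2^-reflect-< b lower upper =
  ≰⇒> (λ y≤x → <⇒≱ upper (≤-trans (*-monoʳ-≤ b (^-monoʳ-≤ 2 y≤x)) lower))

-- Defs keeps the search loop of floorLog2Ratio in an anonymous where-block, so it has no
-- name here. `search a b fuel k` is that loop: the with-abstraction below turns its
-- arguments into distinct variables, and unification then solves `search` for it.
mutual
  search : ℕ → ℕ → ℕ → ℕ → ℕ
  search = _

  floorLog2Ratio-suc : ∀ a b →
    floorLog2Ratio (suc a) b ≡ (if b * 2 ^ 1 ≤ᵇ suc a then search (suc a) b a 1 else 0)
  floorLog2Ratio-suc a b with suc a | 1
  ... | _ | _ = refl

search-lower : ∀ {a} b f k → b * 2 ^ k ≤ a → b * 2 ^ search a b f k ≤ a
search-lower     b zero    k lower = lower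
search-lower {a} b (suc f) k lower with b * 2 ^ suc k ≤ᵇ a | ≤ᵇ-reflects-≤ (b * 2 ^ suc k) a
... | true  | ofʸ lower′ = search-lower b f (suc k) lower′
... | false | ofⁿ _      = lower

search-upper : ∀ {a} b f k → a < b * 2 ^ suc (f + k) → a < b * 2 ^ suc (search a b f k)
search-upper     b zero    k upper = upper
search-upper {a} b (suc f) k upper with b * 2 ^ suc k ≤ᵇ a | ≤ᵇ-reflects-≤ (b * 2 ^ suc k) a
... | true  | ofʸ _      = search-upper b f (suc k) (subst (λ e → a < b * 2 ^ suc e) (sym (+-suc f k)) upper)
... | false | ofⁿ upper′ = ≰⇒> upper′

floorLog2Ratio-lower : ∀ {a} b → b ≤ a → b * 2 ^ floorLog2Ratio a b ≤ a
floorLog2Ratio-lower {a} b b≤a = search-lower b a 0 (subst (_≤ a) (sym (*-identityʳ b)) b≤a)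

floorLog2Ratio-upper : ∀ a b .{{_ : NonZero b}} → a < b * 2 ^ suc (floorLog2Ratio a b)
floorLog2Ratio-upper a b = search-upper b a 0 (begin-strict
  a                   <⟨ n<2^n a ⟩
  2 ^ a               ≤⟨ ^-monoʳ-≤ 2 (n≤1+n a) ⟩
  2 ^ suc a           ≤⟨ m≤n*m (2 ^ suc a) b ⟩
  b * 2 ^ suc a       ≡⟨ cong (λ e → b * 2 ^ suc e) (+-identityʳ a) ⟨
  b * 2 ^ suc (a + 0) ∎)
  where open ≤-Reasoning

floorLog2Ratio-unique : ∀ {a} b {k} .{{_ : NonZero b}} →
                        b * 2 ^ k ≤ a → a < b * 2 ^ suc k → floorLog2Ratio a b ≡ k
floorLog2Ratio-unique {a} b {k} lower upper = ≤-antisym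
  (≤-pred (*-2^-reflect-< b (floorLog2Ratio-lower b b≤a) upper))
  (≤-pred (*-2^-reflect-< b lower (floorLog2Ratio-upper a b)))
  where
  b≤a : b ≤ a
  b≤a = ≤-trans (≤-trans (≤-reflexive (sym (*-identityʳ b))) (*-monoʳ-≤ b (m^n>0 2 k))) lower

floorLog2Ratio-small : ∀ {a} b .{{_ : NonZero b}} → b ≤ a → a < b + b → floorLog2Ratio a b ≡ 0
floorLog2Ratio-small {a} b b≤a a<b+b = floorLog2Ratio-unique b
  (subst (_≤ a) (sym (*-identityʳ b)) b≤a)
  (subst (a <_) (sym (trans (*-2^-suc b 0) (cong (λ x → x + x) (*-identityʳ b)))) a<b+b)

floorLog2Ratio-half : ∀ {a} b .{{_ : NonZero b}} →
                      b + b ≤ a → floorLog2Ratio a b ≡ suc (floorLog2Ratio ⌊ a /2⌋ b)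
floorLog2Ratio-half {a} b b+b≤a = floorLog2Ratio-unique b
  (subst (_≤ a) (sym (*-2^-suc b r)) (m≤⌊n/2⌋⇒m+m≤n (floorLog2Ratio-lower b (m+m≤n⇒m≤⌊n/2⌋ b+b≤a))))
  (subst (a <_) (sym (*-2^-suc b (suc r))) (⌊n/2⌋<m⇒n<m+m (floorLog2Ratio-upper ⌊ a /2⌋ b)))
  where
  r = floorLog2Ratio ⌊ a /2⌋ b

c'-fuel-irrelevant : ∀ {f g} n → n ≤ f → n ≤ g → c' f n ≡ c' g n
c'-fuel-irrelevant {zero}  {zero}  zero _ _ = refl
c'-fuel-irrelevant {zero}  {suc _} zero _ _ = refl
c'-fuel-irrelevant {suc _} {zero}  zero _ _ = refl
c'-fuel-irrelevant {suc _} {suc _} zero _ _ = refl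
c'-fuel-irrelevant {suc _} {suc _} 1    _ _ = refl
c'-fuel-irrelevant {suc _} {suc _} 2    _ _ = refl
c'-fuel-irrelevant {suc _} {suc _} 3    _ _ = refl
c'-fuel-irrelevant {suc _} {suc _} n@(suc (suc (suc (suc k)))) n≤1+f n≤1+g =
  cong (⌊ n /2⌋ * ⌈ n /2⌉ +_) (c'-fuel-irrelevant ⌈ n /2⌉ (half≤ n≤1+f) (half≤ n≤1+g))
  where
  half≤ : ∀ {h} → n ≤ suc h → ⌈ n /2⌉ ≤ h
  half≤ n≤1+h = ≤-pred (≤-trans (⌈n/2⌉<n (suc (suc k))) n≤1+h)

c-recurrence : ∀ m → 3 ≤ m → c (suc m) ≡ ⌈ m /2⌉ * suc ⌊ m /2⌋ + c (suc ⌊ m /2⌋)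
c-recurrence 1 (s≤s ())
c-recurrence 2 (s≤s (s≤s ()))
c-recurrence m@(suc (suc (suc k))) _ =
  cong (⌈ m /2⌉ * suc ⌊ m /2⌋ +_) (c'-fuel-irrelevant (suc ⌊ m /2⌋) (⌊n/2⌋<n (suc (suc k))) ≤-refl)

oddWeight : ℕ → ℕ → ℕ
oddWeight m j = j * (1 + floorLog2Ratio m (2 * j + 1))

oddWeightSum : ℕ → ℕ → ℕ
oddWeightSum s m = sumBelow (⌈ m /2⌉ ∸ s) (λ i → oddWeight m (s + i))

oddWeightSum-half : ∀ s m →
  oddWeightSum s m ≡ sumBelow (⌈ m /2⌉ ∸ s) (s +_) + oddWeightSum s ⌊ m /2⌋
oddWeightSum-half s m = begin
  oddWeightSum s m
    ≡⟨ sumBelow-cong N (λ i _ → *-suc (s + i) (floorLog2Ratio m (d i))) ⟩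
  sumBelow N (λ i → s + i + tail i)
    ≡⟨ sumBelow-+ N (s +_) tail ⟩
  sumBelow N (s +_) + sumBelow N tail
    ≡⟨ cong (sumBelow N (s +_) +_) (sumBelow-truncate tail K≤N vanish) ⟩
  sumBelow N (s +_) + sumBelow K tail
    ≡⟨ cong (sumBelow N (s +_) +_) (sumBelow-cong K halve) ⟩
  sumBelow N (s +_) + oddWeightSum s q ∎
  where
  open ≡-Reasoning
  q = ⌊ m /2⌋
  N = ⌈ m /2⌉ ∸ s
  K = ⌈ q /2⌉ ∸ s
  d : ℕ → ℕ
  d i = 2 * (s + i) + 1
  tail : ℕ → ℕ
  tail i = (s + i) * floorLog2Ratio m (d i)
  K≤N : K ≤ N
  K≤N = ∸-monoˡ-≤ s (⌈n/2⌉-mono (⌊n/2⌋≤n m))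
  halve : ∀ i → i < K → tail i ≡ oddWeight q (s + i)
  halve i i<K = cong ((s + i) *_) (floorLog2Ratio-half (d i) {{2m+1-nonZero (s + i)}}
    (m≤⌊n/2⌋⇒m+m≤n (m<⌈n/2⌉⇒2m+1≤n (s + i) (m<n∸o⇒o+m<n {o = s} i<K))))
  vanish : ∀ i → K ≤ i → i < N → tail i ≡ 0
  vanish i K≤i i<N = trans
    (cong ((s + i) *_) (floorLog2Ratio-small (d i) {{2m+1-nonZero (s + i)}} d≤m m<d+d))
    (*-zeroʳ (s + i))
    where
    d≤m : d i ≤ m
    d≤m = m<⌈n/2⌉⇒2m+1≤n (s + i) (m<n∸o⇒o+m<n {o = s} i<N)
    m<d+d : m < d i + d i
    m<d+d = ⌊n/2⌋<m⇒n<m+m (⌈n/2⌉≤m⇒n<2m+1 (s + i) (≤-trans (m≤n+m∸n ⌈ q /2⌉ s) (+-monoʳ-≤ s K≤i)))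

c+⌊log₂⌋+oddWeightSum≡triangular : ∀ m → 1 ≤ m →
  c (suc m) + ⌊log₂ m ⌋ + oddWeightSum 2 m ≡ triangular (suc m)
c+⌊log₂⌋+oddWeightSum≡triangular = <-rec P step
  where
  P : ℕ → Set
  P m = 1 ≤ m → c (suc m) + ⌊log₂ m ⌋ + oddWeightSum 2 m ≡ triangular (suc m)
  step : ∀ m → (∀ {q} → q < m → P q) → P m
  step 1 _ _ = refl
  step 2 _ _ = refl
  step m@(suc (suc (suc k))) ih _ = begin
    c (suc m) + ⌊log₂ m ⌋ + oddWeightSum 2 m
      ≡⟨ cong₂ (λ x y → x + y + oddWeightSum 2 m) (c-recurrence m (s≤s (s≤s (s≤s z≤n))))
                                                   (⌊log₂⌋-half m (s≤s (s≤s z≤n))) ⟩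
    A * suc q + c (suc q) + suc ⌊log₂ q ⌋ + oddWeightSum 2 m
      ≡⟨ cong (A * suc q + c (suc q) + suc ⌊log₂ q ⌋ +_) (oddWeightSum-half 2 m) ⟩
    A * suc q + c (suc q) + suc ⌊log₂ q ⌋ + (Σ + oddWeightSum 2 q)
      ≡⟨ regroup (A * suc q) (c (suc q)) ⌊log₂ q ⌋ Σ (oddWeightSum 2 q) ⟩
    suc Σ + A * suc q + (c (suc q) + ⌊log₂ q ⌋ + oddWeightSum 2 q)
      ≡⟨ cong (suc Σ + A * suc q +_) (ih (⌊n/2⌋<n (suc (suc k))) (s≤s z≤n)) ⟩
    suc Σ + A * suc q + triangular (suc q)
      ≡⟨⟩ -- A = 2 + ⌊ k /2⌋, so triangular A unfolds to 0 + (1 + Σ)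
    triangular A + A * suc q + triangular (suc q)
      ≡⟨ triangular-+ A (suc q) ⟨
    triangular (A + suc q)
      ≡⟨ cong triangular (trans (+-suc A q) (cong suc (trans (+-comm A q) (⌊n/2⌋+⌈n/2⌉≡n m)))) ⟩
    triangular (suc m) ∎
    where
    open ≡-Reasoning
    q = ⌊ m /2⌋
    A = ⌈ m /2⌉
    Σ = sumBelow (A ∸ 2) (2 +_)
    regroup : ∀ x y z u v → x + y + suc z + (u + v) ≡ suc u + x + (y + z + v)
    regroup = solve-∀

c+⌊log₂⌋+sumFromTo≡⌊n²∸n/2⌋ : ∀ m → 1 ≤ m →
  c (suc m) + ⌊log₂ m ⌋ + sumFromTo 2 ⌊ (m ∸ 1) /2⌋ (oddWeight m) ≡ ⌊ (suc m * suc m ∸ suc m) /2⌋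
c+⌊log₂⌋+sumFromTo≡⌊n²∸n/2⌋ m@(suc _) 1≤m = begin
  c (suc m) + ⌊log₂ m ⌋ + sumFromTo 2 ⌊ (m ∸ 1) /2⌋ (oddWeight m)
    ≡⟨ cong (c (suc m) + ⌊log₂ m ⌋ +_) (sumFromTo≡sumBelow 2 ⌊ (m ∸ 1) /2⌋ (oddWeight m)) ⟩
  c (suc m) + ⌊log₂ m ⌋ + oddWeightSum 2 m
    ≡⟨ c+⌊log₂⌋+oddWeightSum≡triangular m 1≤m ⟩
  triangular (suc m)
    ≡⟨ triangular≡⌊n²∸n/2⌋ (suc m) ⟩
  ⌊ (suc m * suc m ∸ suc m) /2⌋ ∎
  where open ≡-Reasoning

m+n+o≡p⇒+m≡+p-+n-+o : ∀ {m n o p} → m + n + o ≡ p → ℤ.+ m ≡ ℤ.+ p ℤ.- ℤ.+ n ℤ.- ℤ.+ o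
m+n+o≡p⇒+m≡+p-+n-+o {m} {n} {o} refl = trans
  (cancel (ℤ.+ m) (ℤ.+ n) (ℤ.+ o))
  (cong (λ x → x ℤ.- ℤ.+ n ℤ.- ℤ.+ o) (sym (trans (pos-+ (m + n) o) (cong (ℤ._+ ℤ.+ o) (pos-+ m n)))))
  where
  cancel : ∀ a b c → a ≡ a ℤ.+ b ℤ.+ c ℤ.- b ℤ.- c
  cancel = ℤ-Solver.solve-∀

-- Opened only here: the prefix +_ makes sections such as (x +_) above ambiguous.
open import Data.Integer using (+_; _-_)

mainTheorem19 : (n : ℕ) → 2 ≤ n →
    + c n ≡ + ⌊ (n Data.Nat.* n ∸ n) /2⌋ - + ⌊log₂ (n ∸ 1) ⌋
            - + sumFromTo 2 ⌊ (n ∸ 2) /2⌋ (λ j → j Data.Nat.* (1 Data.Nat.+ floorLog2Ratio (n ∸ 1) (2 Data.Nat.* j Data.Nat.+ 1)))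
mainTheorem19 (suc m) (s≤s 1≤m) = m+n+o≡p⇒+m≡+p-+n-+o (c+⌊log₂⌋+sumFromTo≡⌊n²∸n/2⌋ m 1≤m)
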